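{- Let $T$ be a tree with at least two vertices. Then $\chi_o(T)=2$ if every vertex of $T$ has odd degree, and $\chi_o(T)=3$ otherwise.
   Context: All graphs are finite, simple and undirected. A proper vertex coloring $\varphi$ of a graph $G$ is called an odd coloring if for every non-isolated vertex $x$ of $G$ there is a color $c$ such that the number of neighbors $y\in N(x)$ with $\varphi(y)=c$ is odd. The odd chromatic number $\chi_o(G)$ is the minimum number of colors in an odd coloring of $G$. -}

module Defs where

open import Data.Nat using (ℕ; zero; suc; _+_; _≤_; _%_)
open import Data.Fin using (Fin; zero; suc; _≟_)
open import Data.Bool using (Bool; true; false; if_then_else_; _∧_)
open import Data.List using (List; []; _∷_)
open import Data.List.Relation.Unary.Unique.Propositional using (Unique)
open import Data.Product using (Σ; ∃; _×_)
open import Data.Unit using (⊤)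
open import Data.Empty using (⊥)
open import Relation.Binary.PropositionalEquality using (_≡_; _≢_)
open import Relation.Nullary using (¬_)
open import Relation.Nullary.Decidable using (⌊_⌋)

record Graph (n : ℕ) : Set where
  field
    adj    : Fin n → Fin n → Bool
    sym    : ∀ x y → adj x y ≡ adj y x
    irrefl : ∀ x → adj x x ≡ false
open Graph public

count : ∀ {n} → (Fin n → Bool) → ℕ
count {zero}  p = 0
count {suc n} p = (if p zero then 1 else 0) + count (λ i → p (suc i))

Odd : ℕ → Set
Odd m = m % 2 ≡ 1

degree : ∀ {n} → Graph n → Fin n → ℕ
degree G x = count (λ y → adj G x y)

IsWalk : ∀ {n} → Graph n → List (Fin n) → Set
IsWalk G []             = ⊤
IsWalk G (x ∷ [])       = ⊤
IsWalk G (x ∷ y ∷ rest) = (adj G x y ≡ true) × IsWalk G (y ∷ rest)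

last : ∀ {A : Set} → A → List A → A
last a []       = a
last a (b ∷ bs) = last b bs

Connected : ∀ {n} → Graph n → Set
Connected {n} G = ∀ (x y : Fin n) →
  ∃ λ (rest : List (Fin n)) → IsWalk G (x ∷ rest) × last x rest ≡ y

IsCycle : ∀ {n} → Graph n → List (Fin n) → Set
IsCycle G []                  = ⊥
IsCycle G (_ ∷ [])            = ⊥
IsCycle G (_ ∷ _ ∷ [])        = ⊥
IsCycle G (a ∷ b ∷ c ∷ rest)  =
  Unique (a ∷ b ∷ c ∷ rest) × IsWalk G (a ∷ b ∷ c ∷ rest) × (adj G (last c rest) a ≡ true)

Acyclic : ∀ {n} → Graph n → Set
Acyclic {n} G = ∀ (vs : List (Fin n)) → ¬ IsCycle G vs

IsTree : ∀ {n} → Graph n → Set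
IsTree G = Connected G × Acyclic G

IsOddColoring : ∀ {n} → Graph n → (k : ℕ) → (Fin n → Fin k) → Set
IsOddColoring {n} G k φ =
  (∀ x y → adj G x y ≡ true → φ x ≢ φ y) ×
  (∀ x → degree G x ≢ 0 →
     ∃ λ (c : Fin k) → Odd (count (λ y → adj G x y ∧ ⌊ φ y ≟ c ⌋)))

HasOddColoring : ∀ {n} → Graph n → ℕ → Set
HasOddColoring {n} G k = ∃ λ (φ : Fin n → Fin k) → IsOddColoring G k φ

OddChromaticNumber≡ : ∀ {n} → Graph n → ℕ → Set
OddChromaticNumber≡ G m = HasOddColoring G m × (∀ k → HasOddColoring G k → m ≤ k)

{-# OPTIONS --safe #-}
-- Every forest has a vertex of degree at most one: follow a path greedily
-- until it cannot be extended, which by acyclicity happens at a vertex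
-- with only its predecessor as neighbor. Removing such vertices one at a
-- time, a forest is properly 2-colored (give a pendant vertex the color
-- its neighbor lacks) and oddly 3-colored (give a pendant vertex a color
-- different both from its neighbor u and from a color seen an odd number
-- of times at u; the pendant vertex sees u's color exactly once).
-- When all degrees are odd, the proper 2-coloring is odd, since every
-- vertex sees its whole neighborhood in the other color. Conversely, in an
-- odd 2-coloring each vertex sees no neighbor in its own color, so all
-- its neighbors, hence an odd number of them, carry the other color.
module Submission where

open import Defs hiding (sym; irrefl)
open import Data.Nat using (ℕ; zero; suc; _+_; _≤_; z≤n; s≤s)
import Data.Nat as ℕ
open import Data.Nat.Properties using (suc-injective; ≤∧≢⇒<; +-commutativeSemigroup)
open import Algebra.Properties.CommutativeSemigroup +-commutativeSemigroup using (x∙yz≈y∙xz)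
open import Data.Fin using (Fin; zero; suc; toℕ; punchIn; punchOut; opposite; _≟_)
open import Data.Fin.Properties
  using (punchInᵢ≢i; punchIn-punchOut; punchIn-injective; any?)
open import Data.Vec.Functional using (insertAt)
open import Data.Vec.Functional.Properties using (insertAt-lookup; insertAt-punchIn)
open import Data.Bool using (Bool; true; false; if_then_else_; _∧_)
open import Data.Bool.Properties using (¬-not; ∧-conicalˡ)
import Data.Bool.Properties as Bool
open import Data.List using (List; []; _∷_; map; take; lookup; length)
open import Data.List.Relation.Unary.All using ([]; _∷_)
open import Data.List.Relation.Unary.Any using (here; there; index)
open import Data.List.Relation.Unary.Any.Properties using (lookup-index)
open import Data.List.Relation.Unary.All.Properties using (¬Any⇒All¬)
open import Data.List.Relation.Unary.AllPairs using ([]; _∷_)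
open import Data.List.Relation.Unary.Unique.Propositional using (Unique)
import Data.List.Relation.Unary.Unique.Propositional.Properties as Unique
open import Data.List.Membership.Propositional using (_∈_; _∉_)
import Data.List.Membership.DecPropositional as DecMembership
open import Data.Product using (∃; _×_; _,_; proj₂)
open import Data.Unit using (tt)
open import Data.Empty using (⊥-elim)
open import Function using (_∘_; _⇔_; mk⇔)
open import Relation.Binary.PropositionalEquality
  using (_≡_; _≢_; refl; sym; trans; cong; cong₂; subst; module ≡-Reasoning)
open import Relation.Nullary using (¬_; Dec; yes; no; contradiction)
open import Relation.Nullary.Decidable
  using (⌊_⌋; _×-dec_; ¬?; isYes≗does; dec-true; dec-false; does-⇔; decidable-stable)

private
  variable
    n k : ℕ

isYes-true : ∀ {a} {A : Set a} (a? : Dec A) → A → ⌊ a? ⌋ ≡ true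
isYes-true a? a = trans (isYes≗does a?) (dec-true a? a)

isYes-false : ∀ {a} {A : Set a} (a? : Dec A) → ¬ A → ⌊ a? ⌋ ≡ false
isYes-false a? ¬a = trans (isYes≗does a?) (dec-false a? ¬a)

isYes-⇔ : ∀ {a b} {A : Set a} {B : Set b} → A ⇔ B → (a? : Dec A) (b? : Dec B) → ⌊ a? ⌋ ≡ ⌊ b? ⌋
isYes-⇔ A⇔B a? b? = trans (isYes≗does a?) (trans (does-⇔ A⇔B a? b?) (sym (isYes≗does b?)))

data PunchInView (i : Fin (suc n)) : Fin (suc n) → Set where
  pivot   : PunchInView i i
  punched : ∀ j → PunchInView i (punchIn i j)

punchInView : (i x : Fin (suc n)) → PunchInView i x
punchInView i x with i ≟ x
... | yes refl = pivot
... | no i≢x = subst (PunchInView i) (punchIn-punchOut i≢x) (punched (punchOut i≢x))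

indicator : Bool → ℕ
indicator b = if b then 1 else 0

count-cong : {p q : Fin n → Bool} → (∀ i → p i ≡ q i) → count p ≡ count q
count-cong {zero}  p≗q = refl
count-cong {suc n} p≗q = cong₂ _+_ (cong indicator (p≗q zero)) (count-cong (p≗q ∘ suc))

count-allFalse : {p : Fin n → Bool} → (∀ i → p i ≡ false) → count p ≡ 0
count-allFalse {zero}  p≗false = refl
count-allFalse {suc n} p≗false
  rewrite p≗false zero = count-allFalse (p≗false ∘ suc)

count-punchIn : (p : Fin (suc n) → Bool) (i : Fin (suc n)) →
                count p ≡ indicator (p i) + count (p ∘ punchIn i)
count-punchIn p zero = refl
count-punchIn {suc n} p (suc i) = begin
  indicator (p zero) + count (p ∘ suc)
    ≡⟨ cong (indicator (p zero) +_) (count-punchIn (p ∘ suc) i) ⟩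
  indicator (p zero) + (indicator (p (suc i)) + count (p ∘ suc ∘ punchIn i))
    ≡⟨ x∙yz≈y∙xz (indicator (p zero)) (indicator (p (suc i))) _ ⟩
  indicator (p (suc i)) + (indicator (p zero) + count (p ∘ suc ∘ punchIn i)) ∎
  where open ≡-Reasoning

count≢0 : (p : Fin n → Bool) (i : Fin n) → p i ≡ true → count p ≢ 0
count≢0 {suc n} p i pi≡true rewrite count-punchIn p i | pi≡true = λ ()

count≡0⇒false : (p : Fin n → Bool) (i : Fin n) → count p ≡ 0 → p i ≡ false
count≡0⇒false p i count≡0 = ¬-not (λ pi≡true → count≢0 p i pi≡true count≡0)

count-unique : (p : Fin n → Bool) (i : Fin n) → p i ≡ true →
               (∀ j → p j ≡ true → j ≡ i) → count p ≡ 1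
count-unique {suc n} p i pi≡true unique = begin
  count p                                  ≡⟨ count-punchIn p i ⟩
  indicator (p i) + count (p ∘ punchIn i)  ≡⟨ cong₂ _+_ (cong indicator pi≡true) (count-allFalse elsewhere) ⟩
  1                                        ∎
  where
  open ≡-Reasoning
  elsewhere : ∀ j → p (punchIn i j) ≡ false
  elsewhere j = ¬-not (λ p≡true → punchInᵢ≢i i j (unique _ p≡true))

no-loop : (G : Graph n) (x : Fin n) → adj G x x ≢ true
no-loop G x xx = contradiction (trans (sym xx) (Graph.irrefl G x)) λ ()

removeVertex : Graph (suc n) → Fin (suc n) → Graph n
removeVertex G ℓ = record
  { adj    = λ i j → adj G (punchIn ℓ i) (punchIn ℓ j)
  ; sym    = λ i j → Graph.sym G (punchIn ℓ i) (punchIn ℓ j)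
  ; irrefl = λ i → Graph.irrefl G (punchIn ℓ i)
  }

degree-removeVertex : (G : Graph (suc n)) (ℓ : Fin (suc n)) (j : Fin n) →
  degree G (punchIn ℓ j) ≡ indicator (adj G (punchIn ℓ j) ℓ) + degree (removeVertex G ℓ) j
degree-removeVertex G ℓ j = count-punchIn (adj G (punchIn ℓ j)) ℓ

last-map : ∀ {A B : Set} (f : A → B) (a : A) (xs : List A) → last (f a) (map f xs) ≡ f (last a xs)
last-map f a []       = refl
last-map f a (b ∷ xs) = last-map f b xs

IsWalk-removeVertex : (G : Graph (suc n)) (ℓ : Fin (suc n)) (vs : List (Fin n)) →
  IsWalk (removeVertex G ℓ) vs → IsWalk G (map (punchIn ℓ) vs)
IsWalk-removeVertex G ℓ []           _        = tt
IsWalk-removeVertex G ℓ (_ ∷ [])     _        = tt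
IsWalk-removeVertex G ℓ (_ ∷ y ∷ vs) (e , w) = e , IsWalk-removeVertex G ℓ (y ∷ vs) w

Acyclic-removeVertex : (G : Graph (suc n)) (ℓ : Fin (suc n)) → Acyclic G → Acyclic (removeVertex G ℓ)
Acyclic-removeVertex G ℓ acyclic vs@(a ∷ b ∷ c ∷ rest) (unique , walk , closing) =
  acyclic (map (punchIn ℓ) vs)
    ( Unique.map⁺ (punchIn-injective ℓ _ _) unique
    , IsWalk-removeVertex G ℓ vs walk
    , subst (λ z → adj G z (punchIn ℓ a) ≡ true) (sym (last-map (punchIn ℓ) c rest)) closing )

connected⇒neighbor : (G : Graph n) → Connected G → {x y : Fin n} → x ≢ y → ∃ λ z → adj G x z ≡ true
connected⇒neighbor G connected {x} {y} x≢y with connected x y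
... | []    , _        , x≡y = contradiction x≡y x≢y
... | z ∷ _ , (xz , _) , _   = z , xz

IsWalk-take : (G : Graph n) (k : ℕ) (xs : List (Fin n)) → IsWalk G xs → IsWalk G (take k xs)
IsWalk-take G zero          xs           _        = tt
IsWalk-take G (suc k)       []           _        = tt
IsWalk-take G (suc zero)    (x ∷ xs)     _        = tt
IsWalk-take G (suc (suc k)) (x ∷ [])     _        = tt
IsWalk-take G (suc (suc k)) (x ∷ y ∷ xs) (xy , w) = xy , IsWalk-take G (suc k) (y ∷ xs) w

last-take : ∀ {A : Set} (a : A) (xs : List A) (i : Fin (length xs)) →
            last a (take (suc (toℕ i)) xs) ≡ lookup xs i
last-take a (x ∷ xs) zero    = refl
last-take a (x ∷ xs) (suc i) = last-take x xs i

∉-∷⇔ : ∀ {A : Set} {v w : A} {vs : List A} → v ≢ w → (v ∉ vs) ⇔ (v ∉ w ∷ vs)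
∉-∷⇔ v≢w = mk⇔ (λ { v∉vs (here v≡w) → v≢w v≡w ; v∉vs (there v∈vs) → v∉vs v∈vs })
                (λ v∉w∷vs v∈vs → v∉w∷vs (there v∈vs))

-- The pendant neighbor is named by its index in the graph with ℓ removed.
data DegreeAtMostOne (G : Graph (suc n)) (ℓ : Fin (suc n)) : Set where
  isolated : (∀ y → adj G ℓ y ≡ false) → DegreeAtMostOne G ℓ
  pendant  : ∀ u → adj G ℓ (punchIn ℓ u) ≡ true →
             (∀ v → adj G ℓ (punchIn ℓ v) ≡ true → v ≡ u) → DegreeAtMostOne G ℓ

pendantAt : (G : Graph (suc n)) {ℓ u : Fin (suc n)} → adj G ℓ u ≡ true →
            (∀ y → adj G ℓ y ≡ true → y ≡ u) → DegreeAtMostOne G ℓ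
pendantAt G {ℓ} {u} ℓu unique with punchInView ℓ u
... | pivot     = contradiction ℓu (no-loop G ℓ)
... | punched j = pendant j ℓu (λ v ℓv → punchIn-injective ℓ v j (unique _ ℓv))

module PathExtension {m : ℕ} (G : Graph (suc m)) (acyclic : Acyclic G) where
  open DecMembership (_≟_ {suc m}) using (_∈?_; _∉?_)

  Vertex : Set
  Vertex = Fin (suc m)

  adj? : ∀ x y → Dec (adj G x y ≡ true)
  adj? x y = adj G x y Bool.≟ true

  offPath : List Vertex → Vertex → Bool
  offPath vs v = ⌊ v ∉? vs ⌋

  count-offPath-∷ : ∀ {w vs} → w ∉ vs → count (offPath vs) ≡ suc (count (offPath (w ∷ vs)))
  count-offPath-∷ {w} {vs} w∉vs = begin
    count (offPath vs)
      ≡⟨ count-punchIn (offPath vs) w ⟩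
    indicator (offPath vs w) + count (offPath vs ∘ punchIn w)
      ≡⟨ cong₂ _+_ (cong indicator (isYes-true (w ∉? vs) w∉vs)) (count-cong unchanged) ⟩
    suc (count (offPath (w ∷ vs) ∘ punchIn w))
      ≡⟨ cong (λ b → suc (indicator b + count (offPath (w ∷ vs) ∘ punchIn w))) (sym (isYes-false (w ∉? w ∷ vs) (λ w∉ → w∉ (here refl)))) ⟩
    suc (indicator (offPath (w ∷ vs) w) + count (offPath (w ∷ vs) ∘ punchIn w))
      ≡⟨ cong suc (sym (count-punchIn (offPath (w ∷ vs)) w)) ⟩
    suc (count (offPath (w ∷ vs))) ∎
    where
    open ≡-Reasoning
    unchanged : ∀ j → offPath vs (punchIn w j) ≡ offPath (w ∷ vs) (punchIn w j)
    unchanged j = isYes-⇔ (∉-∷⇔ (punchInᵢ≢i w j)) _ _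

  closingCycle : ∀ {c p w rest} (w∈rest : w ∈ rest) → Unique (c ∷ p ∷ rest) →
    IsWalk G (c ∷ p ∷ rest) → adj G w c ≡ true →
    IsCycle G (take (3 + toℕ (index w∈rest)) (c ∷ p ∷ rest))
  closingCycle {c} {p} {w} {x ∷ xs} w∈rest unique walk wc =
    Unique.take⁺ (3 + i) unique ,
    IsWalk-take G (3 + i) _ walk ,
    subst (λ z → adj G z c ≡ true) w≡last wc
    where
    i : ℕ
    i = toℕ (index w∈rest)
    w≡last : w ≡ last p (take (suc i) (x ∷ xs))
    w≡last = trans (lookup-index w∈rest) (sym (last-take p (x ∷ xs) (index w∈rest)))

  -- The fuel k counts the vertices not yet on the path c ∷ p ∷ rest (stored in reverse).
  extendPath : (k : ℕ) (c p : Vertex) (rest : List Vertex) → count (offPath (c ∷ p ∷ rest)) ≡ k →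
               Unique (c ∷ p ∷ rest) → IsWalk G (c ∷ p ∷ rest) → ∃ (DegreeAtMostOne G)
  extendPath k c p rest offCount unique walk@(cp , _) with any? (λ y → adj? c y ×-dec ¬? (y ≟ p))
  ... | no noOther =
    c , pendantAt G cp (λ y cy → decidable-stable (y ≟ p) (λ y≢p → noOther (y , cy , y≢p)))
  ... | yes (w , cw , w≢p) with w ∈? (c ∷ p ∷ rest)
  ...   | yes (here refl)            = contradiction cw (no-loop G c)
  ...   | yes (there (here w≡p))     = contradiction w≡p w≢p
  ...   | yes (there (there w∈rest)) =
    ⊥-elim (acyclic _ (closingCycle w∈rest unique walk (trans (Graph.sym G w c) cw)))
  ...   | no w∉path with k
  ...     | zero   = contradiction offCount (count≢0 (offPath (c ∷ p ∷ rest)) w (isYes-true (w ∉? _) w∉path))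
  ...     | suc k′ =
    extendPath k′ w c (p ∷ rest) (suc-injective (trans (sym (count-offPath-∷ w∉path)) offCount))
               (¬Any⇒All¬ _ w∉path ∷ unique) (trans (Graph.sym G w c) cw , walk)

  ∃degreeAtMostOne : ∃ (DegreeAtMostOne G)
  ∃degreeAtMostOne with any? (adj? zero)
  ... | no noNeighbor = zero , isolated (λ y → ¬-not (λ zy → noNeighbor (y , zy)))
  ... | yes (w , zw)   =
    extendPath _ w zero [] refl ((w≢zero ∷ []) ∷ [] ∷ []) (trans (Graph.sym G w zero) zw , tt)
    where
    w≢zero : w ≢ zero
    w≢zero refl = no-loop G zero zw

acyclic⇒∃degreeAtMostOne : (G : Graph (suc n)) → Acyclic G → ∃ (DegreeAtMostOne G)
acyclic⇒∃degreeAtMostOne G acyclic = PathExtension.∃degreeAtMostOne G acyclic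

acyclic-induction : (P : ∀ {n} → Graph n → Set) → ((G : Graph 0) → P G) →
  (∀ {n} (G : Graph (suc n)) ℓ → DegreeAtMostOne G ℓ → P (removeVertex G ℓ) → P G) →
  (G : Graph n) → Acyclic G → P G
acyclic-induction {zero}  P base step G acyclic = base G
acyclic-induction {suc n} P base step G acyclic
  with ℓ , ℓ-degree ← acyclic⇒∃degreeAtMostOne G acyclic =
  step G ℓ ℓ-degree (acyclic-induction P base step (removeVertex G ℓ) (Acyclic-removeVertex G ℓ acyclic))

Fin2-≢⇒≡ : {a b c : Fin 2} → a ≢ c → b ≢ c → a ≡ b
Fin2-≢⇒≡ {zero}     {zero}     _   _   = refl
Fin2-≢⇒≡ {suc zero} {suc zero} _   _   = refl
Fin2-≢⇒≡ {zero}     {suc zero} {zero}     a≢c _ = contradiction refl a≢c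
Fin2-≢⇒≡ {zero}     {suc zero} {suc zero} _ b≢c = contradiction refl b≢c
Fin2-≢⇒≡ {suc zero} {zero}     {zero}     _ b≢c = contradiction refl b≢c
Fin2-≢⇒≡ {suc zero} {zero}     {suc zero} a≢c _ = contradiction refl a≢c

opposite₂-≢ : (a : Fin 2) → opposite a ≢ a
opposite₂-≢ zero       ()
opposite₂-≢ (suc zero) ()

Fin3-avoid : (a b : Fin 3) → ∃ λ c → c ≢ a × c ≢ b
Fin3-avoid zero             zero             = suc zero       , (λ ()) , (λ ())
Fin3-avoid zero             (suc zero)       = suc (suc zero) , (λ ()) , (λ ())
Fin3-avoid zero             (suc (suc zero)) = suc zero       , (λ ()) , (λ ())
Fin3-avoid (suc zero)       zero             = suc (suc zero) , (λ ()) , (λ ())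
Fin3-avoid (suc zero)       (suc zero)       = zero           , (λ ()) , (λ ())
Fin3-avoid (suc zero)       (suc (suc zero)) = zero           , (λ ()) , (λ ())
Fin3-avoid (suc (suc zero)) zero             = suc zero       , (λ ()) , (λ ())
Fin3-avoid (suc (suc zero)) (suc zero)       = zero           , (λ ()) , (λ ())
Fin3-avoid (suc (suc zero)) (suc (suc zero)) = zero           , (λ ()) , (λ ())

Proper : Graph n → (Fin n → Fin k) → Set
Proper {n} G φ = ∀ (x y : Fin n) → adj G x y ≡ true → φ x ≢ φ y

colorDegree : Graph n → (Fin n → Fin k) → Fin n → Fin k → ℕ
colorDegree G φ x c = count (λ y → adj G x y ∧ ⌊ φ y ≟ c ⌋)

OddAt : Graph n → (Fin n → Fin k) → Fin n → Set
OddAt {k = k} G φ x = degree G x ≢ 0 → ∃ λ (c : Fin k) → Odd (colorDegree G φ x c)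

proper-edge⇒2≤k : (G : Graph n) (φ : Fin n → Fin k) → Proper G φ →
                  ∀ {x y} → adj G x y ≡ true → 2 ≤ k
proper-edge⇒2≤k {k = zero}        G φ proper {x}     xy with () ← φ x
proper-edge⇒2≤k {k = suc zero}    G φ proper {x} {y} xy = contradiction (Fin1-≡ (φ x) (φ y)) (proper x y xy)
  where
  Fin1-≡ : (a b : Fin 1) → a ≡ b
  Fin1-≡ zero zero = refl
proper-edge⇒2≤k {k = suc (suc k)} G φ proper         xy = s≤s (s≤s z≤n)

colorDegree-monochromatic : (G : Graph n) (φ : Fin n → Fin k) (x : Fin n) (c : Fin k) →
  (∀ y → adj G x y ≡ true → φ y ≡ c) → colorDegree G φ x c ≡ degree G x
colorDegree-monochromatic G φ x c mono = count-cong neighborHasColor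
  where
  neighborHasColor : ∀ y → (adj G x y ∧ ⌊ φ y ≟ c ⌋) ≡ adj G x y
  neighborHasColor y with adj G x y in xy
  ... | false = refl
  ... | true  = isYes-true (φ y ≟ c) (mono y xy)

colorDegree-own : (G : Graph n) (φ : Fin n → Fin k) → Proper G φ → ∀ x → colorDegree G φ x (φ x) ≡ 0
colorDegree-own G φ proper x = count-allFalse otherColor
  where
  otherColor : ∀ y → (adj G x y ∧ ⌊ φ y ≟ φ x ⌋) ≡ false
  otherColor y with adj G x y in xy
  ... | false = refl
  ... | true  = isYes-false (φ y ≟ φ x) (λ φy≡φx → proper x y xy (sym φy≡φx))

colorDegree-isolated : (G : Graph n) (φ : Fin n → Fin k) {x : Fin n} (c : Fin k) →
  degree G x ≡ 0 → colorDegree G φ x c ≡ 0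
colorDegree-isolated G φ {x} c deg≡0 =
  count-allFalse (λ y → cong (_∧ ⌊ φ y ≟ c ⌋) (count≡0⇒false (adj G x) y deg≡0))

proper₂⇒oddColoring : (G : Graph n) (ψ : Fin n → Fin 2) → Proper G ψ →
  (∀ x → Odd (degree G x)) → IsOddColoring G 2 ψ
proper₂⇒oddColoring G ψ proper allOdd = proper , λ x _ →
  opposite (ψ x) , subst Odd (sym (colorDegree-monochromatic G ψ x (opposite (ψ x)) (oppositeNeighbors x))) (allOdd x)
  where
  oppositeNeighbors : ∀ x y → adj G x y ≡ true → ψ y ≡ opposite (ψ x)
  oppositeNeighbors x y xy = Fin2-≢⇒≡ (λ ψy≡ψx → proper x y xy (sym ψy≡ψx)) (opposite₂-≢ (ψ x))

oddColoring₂⇒oddDegree : (G : Graph n) (φ : Fin n → Fin 2) → IsOddColoring G 2 φ →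
  ∀ x → degree G x ≢ 0 → Odd (degree G x)
oddColoring₂⇒oddDegree G φ (proper , odd) x deg≢0 with odd x deg≢0
... | c , oddC with c ≟ φ x
...   | yes refl = contradiction (subst Odd (colorDegree-own G φ proper x) oddC) λ ()
...   | no c≢φx  = subst Odd (colorDegree-monochromatic G φ x c neighborColor) oddC
  where
  neighborColor : ∀ y → adj G x y ≡ true → φ y ≡ c
  neighborColor y xy = Fin2-≢⇒≡ (λ φy≡φx → proper x y xy (sym φy≡φx)) c≢φx

module _ (G : Graph (suc n)) (ℓ : Fin (suc n)) (φ : Fin n → Fin k) (d : Fin k) where

  colorDegree-insertAt : ∀ j c → colorDegree G (insertAt φ ℓ d) (punchIn ℓ j) c ≡
    indicator (adj G (punchIn ℓ j) ℓ ∧ ⌊ d ≟ c ⌋) + colorDegree (removeVertex G ℓ) φ j c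
  colorDegree-insertAt j c = trans (count-punchIn (λ y → adj G (punchIn ℓ j) y ∧ ⌊ insertAt φ ℓ d y ≟ c ⌋) ℓ) (cong₂ _+_
    (cong (λ e → indicator (adj G (punchIn ℓ j) ℓ ∧ ⌊ e ≟ c ⌋)) (insertAt-lookup φ ℓ d))
    (count-cong (λ i → cong (λ e → adj G (punchIn ℓ j) (punchIn ℓ i) ∧ ⌊ e ≟ c ⌋) (insertAt-punchIn φ ℓ d i))))

  proper-insertAt : Proper (removeVertex G ℓ) φ → (∀ j → adj G ℓ (punchIn ℓ j) ≡ true → d ≢ φ j) →
                    Proper G (insertAt φ ℓ d)
  proper-insertAt proper separated x y xy with punchInView ℓ x | punchInView ℓ y
  ... | pivot     | pivot     = contradiction xy (no-loop G ℓ)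
  ... | pivot     | punched j
    rewrite insertAt-lookup φ ℓ d | insertAt-punchIn φ ℓ d j = separated j xy
  ... | punched i | pivot
    rewrite insertAt-lookup φ ℓ d | insertAt-punchIn φ ℓ d i =
    λ φi≡d → separated i (trans (Graph.sym G ℓ _) xy) (sym φi≡d)
  ... | punched i | punched j
    rewrite insertAt-punchIn φ ℓ d i | insertAt-punchIn φ ℓ d j = proper i j xy

  oddAt-insertAt : ∀ j → adj G (punchIn ℓ j) ℓ ≡ false → OddAt (removeVertex G ℓ) φ j →
                   OddAt G (insertAt φ ℓ d) (punchIn ℓ j)
  oddAt-insertAt j jℓ odd deg≢0 with odd (deg≢0 ∘ trans (degree-removeVertex G ℓ j) ∘ cong₂ _+_ (cong indicator jℓ))
  ... | c , oddC = c , subst Odd (sym unchanged) oddC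
    where
    unchanged : colorDegree G (insertAt φ ℓ d) (punchIn ℓ j) c ≡ colorDegree (removeVertex G ℓ) φ j c
    unchanged = trans (colorDegree-insertAt j c)
                      (cong (λ b → indicator (b ∧ ⌊ d ≟ c ⌋) + colorDegree (removeVertex G ℓ) φ j c) jℓ)

acyclic⇒2-colorable : (G : Graph n) → Acyclic G → ∃ λ (ψ : Fin n → Fin 2) → Proper G ψ
acyclic⇒2-colorable = acyclic-induction (λ G → ∃ (Proper G)) (λ G → (λ ()) , (λ ())) extend
  where
  extend : ∀ {n} (G : Graph (suc n)) ℓ → DegreeAtMostOne G ℓ →
           ∃ (Proper {k = 2} (removeVertex G ℓ)) → ∃ (Proper G)
  extend G ℓ (isolated ℓ-isolated) (ψ , proper) =
    insertAt ψ ℓ zero ,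
    proper-insertAt G ℓ ψ zero proper (λ j ℓj → contradiction (trans (sym ℓj) (ℓ-isolated _)) λ ())
  extend G ℓ (pendant u ℓu unique) (ψ , proper) =
    insertAt ψ ℓ (opposite (ψ u)) ,
    proper-insertAt G ℓ ψ (opposite (ψ u)) proper
      (λ j ℓj opposite≡ψj → opposite₂-≢ (ψ u) (trans opposite≡ψj (cong ψ (unique j ℓj))))

oddColoring-isolated : (G : Graph (suc n)) (ℓ : Fin (suc n)) → (∀ y → adj G ℓ y ≡ false) →
  Fin k → HasOddColoring (removeVertex G ℓ) k → HasOddColoring G k
oddColoring-isolated G ℓ ℓ-isolated d (φ , proper , odd) =
  insertAt φ ℓ d ,
  proper-insertAt G ℓ φ d proper (λ j ℓj → contradiction (trans (sym ℓj) (ℓ-isolated _)) λ ()) ,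
  oddAt
  where
  oddAt : ∀ x → OddAt G (insertAt φ ℓ d) x
  oddAt x with punchInView ℓ x
  ... | pivot     = λ deg≢0 → contradiction (count-allFalse ℓ-isolated) deg≢0
  ... | punched j = oddAt-insertAt G ℓ φ d j (trans (Graph.sym G _ ℓ) (ℓ-isolated _)) (odd j)

module _ (G : Graph (suc n)) (ℓ : Fin (suc n)) (u : Fin n) (ℓu : adj G ℓ (punchIn ℓ u) ≡ true)
         (unique : ∀ v → adj G ℓ (punchIn ℓ v) ≡ true → v ≡ u)
         (φ : Fin n → Fin 3) (proper : Proper (removeVertex G ℓ) φ)
         (odd : ∀ x → OddAt (removeVertex G ℓ) φ x) where

  private
    uℓ : adj G (punchIn ℓ u) ℓ ≡ true
    uℓ = trans (Graph.sym G _ ℓ) ℓu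

  -- If u is isolated in G − ℓ it sees d once; otherwise d avoids an odd color of u there.
  pendantColor : ∃ λ d → d ≢ φ u × ∃ λ c → Odd (colorDegree G (insertAt φ ℓ d) (punchIn ℓ u) c)
  pendantColor with degree (removeVertex G ℓ) u ℕ.≟ 0
  ... | yes deg≡0 with Fin3-avoid (φ u) (φ u)
  ...   | d , d≢φu , _ = d , d≢φu , d , subst Odd (sym seenOnce) refl
    where
    seenOnce : colorDegree G (insertAt φ ℓ d) (punchIn ℓ u) d ≡ 1
    seenOnce = trans (colorDegree-insertAt G ℓ φ d u d)
      (cong₂ _+_ (cong indicator (cong₂ _∧_ uℓ (isYes-true (d ≟ d) refl)))
                 (colorDegree-isolated (removeVertex G ℓ) φ d deg≡0))
  pendantColor | no deg≢0 with odd u deg≢0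
  ... | c , oddC with Fin3-avoid (φ u) c
  ...   | d , d≢φu , d≢c = d , d≢φu , c , subst Odd (sym unchanged) oddC
    where
    unchanged : colorDegree G (insertAt φ ℓ d) (punchIn ℓ u) c ≡ colorDegree (removeVertex G ℓ) φ u c
    unchanged = trans (colorDegree-insertAt G ℓ φ d u c)
      (cong (λ b → indicator b + colorDegree (removeVertex G ℓ) φ u c) (cong₂ _∧_ uℓ (isYes-false (d ≟ c) d≢c)))

  oddColoring₃-pendant : HasOddColoring G 3
  oddColoring₃-pendant with pendantColor
  ... | d , d≢φu , oddAtU =
    φ⁺ , proper-insertAt G ℓ φ d proper (λ j ℓj d≡φj → d≢φu (trans d≡φj (cong φ (unique j ℓj)))) , oddAt
    where
    φ⁺ : Fin (suc n) → Fin 3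
    φ⁺ = insertAt φ ℓ d

    ℓ-neighbor : ∀ y → (adj G ℓ y ∧ ⌊ φ⁺ y ≟ φ u ⌋) ≡ true → y ≡ punchIn ℓ u
    ℓ-neighbor y ℓy with punchInView ℓ y
    ... | pivot     = contradiction (∧-conicalˡ _ _ ℓy) (no-loop G ℓ)
    ... | punched v = cong (punchIn ℓ) (unique v (∧-conicalˡ _ _ ℓy))

    ℓ-seesOnce : colorDegree G φ⁺ ℓ (φ u) ≡ 1
    ℓ-seesOnce = count-unique _ (punchIn ℓ u)
      (cong₂ _∧_ ℓu (isYes-true (φ⁺ (punchIn ℓ u) ≟ φ u) (insertAt-punchIn φ ℓ d u))) ℓ-neighbor

    oddAt : ∀ x → OddAt G φ⁺ x
    oddAt x with punchInView ℓ x
    ... | pivot = λ _ → φ u , subst Odd (sym ℓ-seesOnce) refl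
    ... | punched j with j ≟ u
    ...   | yes refl = λ _ → oddAtU
    ...   | no j≢u   = oddAt-insertAt G ℓ φ d j
                         (trans (Graph.sym G _ ℓ) (¬-not (j≢u ∘ unique j))) (odd j)

acyclic⇒oddColoring₃ : (G : Graph n) → Acyclic G → HasOddColoring G 3
acyclic⇒oddColoring₃ = acyclic-induction (λ G → HasOddColoring G 3) (λ G → (λ ()) , (λ ()) , (λ ())) extend
  where
  extend : ∀ {n} (G : Graph (suc n)) ℓ → DegreeAtMostOne G ℓ →
           HasOddColoring (removeVertex G ℓ) 3 → HasOddColoring G 3
  extend G ℓ (isolated ℓ-isolated)  = oddColoring-isolated G ℓ ℓ-isolated zero
  extend G ℓ (pendant u ℓu unique) (φ , proper , odd) =
    oddColoring₃-pendant G ℓ u ℓu unique φ proper odd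

proposition1 : ∀ (n : ℕ) (T : Graph n) → 2 ≤ n → IsTree T →
    ((∀ x → Odd (degree T x)) → OddChromaticNumber≡ T 2) ×
    (¬ (∀ x → Odd (degree T x)) → OddChromaticNumber≡ T 3)
proposition1 (suc (suc _)) T (s≤s (s≤s z≤n)) (connected , acyclic) = allOdd⇒χₒ≡2 , notAllOdd⇒χₒ≡3
  where
  hasNeighbor : ∀ x → ∃ λ y → adj T x y ≡ true
  hasNeighbor x = connected⇒neighbor T connected (punchInᵢ≢i x zero ∘ sym)

  atLeast2 : ∀ k → HasOddColoring T k → 2 ≤ k
  atLeast2 k (φ , proper , _) = proper-edge⇒2≤k T φ proper (proj₂ (hasNeighbor zero))

  allOdd⇒χₒ≡2 : (∀ x → Odd (degree T x)) → OddChromaticNumber≡ T 2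
  allOdd⇒χₒ≡2 allOdd with ψ , proper ← acyclic⇒2-colorable T acyclic =
    (ψ , proper₂⇒oddColoring T ψ proper allOdd) , atLeast2

  notAllOdd⇒χₒ≡3 : ¬ (∀ x → Odd (degree T x)) → OddChromaticNumber≡ T 3
  notAllOdd⇒χₒ≡3 notAllOdd = acyclic⇒oddColoring₃ T acyclic , atLeast3
    where
    atLeast3 : ∀ k → HasOddColoring T k → 3 ≤ k
    atLeast3 k coloring = ≤∧≢⇒< (atLeast2 k coloring) λ { refl → notAllOdd λ x →
      oddColoring₂⇒oddDegree T _ (proj₂ coloring) x (count≢0 (adj T x) _ (proj₂ (hasNeighbor x))) }
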